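{- Let $L$ be a reduced Latin square of order $n$, and for $j=1,\dots,n$ let $\sigma_j$ (resp. $\pi_j$) denote the $j$th row (resp. $j$th column) of $L$, viewed as a permutation. Then for every $\alpha\in S_n$ and every $j\in[n]$, the isotopism $(\alpha,\ \alpha\pi_j\sigma_{\alpha^{ -1}(1)}^{ -1},\ \alpha\pi_j)$ maps $L$ to a reduced Latin square, and every isotopism $\Theta\in S_n^3$ such that $\Theta(L)$ is reduced is of this form for some $\alpha\in S_n$ and $j\in[n]$.
   Context: A Latin square of order $n$ is an $n\times n$ array with entries in $[n]$ in which each symbol appears exactly once in each row and column. Rows and columns are viewed as permutations in $S_n$ via the convention: symbol $i$ in the $j$th place of a row (or column) $\pi$ means $\pi(i)=j$. Permutations are composed right to left. A Latin square is reduced if its first row and first column are the identity permutation. An isotopism $(\alpha,\beta,\gamma)\in S_n^3$ acts on a Latin square by moving the row in position $r$ to position $\alpha(r)$, the column in position $c$ to position $\beta(c)$, and replacing each symbol $s$ by $\gamma(s)$. -}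

module Defs where

open import Data.Nat using (ℕ; suc)
open import Data.Fin using (Fin; zero)
open import Data.Fin.Permutation using (Permutation′; _⟨$⟩ʳ_; _⟨$⟩ˡ_; _∘ₚ_; flip)
open import Data.Product using (_×_)
open import Function.Definitions using (Injective)
open import Relation.Binary.PropositionalEquality using (_≡_)

-- An n×n array with entries in [n] (indexed by Fin n; position/symbol "1" is zero).
Array : ℕ → Set
Array n = Fin n → Fin n → Fin n

-- Composition of permutations, right to left: (α · β)(x) = α (β x).
infixr 9 _·_
_·_ : ∀ {n} → Permutation′ n → Permutation′ n → Permutation′ n
α · β = β ∘ₚ α

_⁻¹ : ∀ {n} → Permutation′ n → Permutation′ n
π ⁻¹ = flip π

-- A Latin square of order n, together with its rows and columns viewed
-- as permutations: symbol i in the j-th place of row r means σ_r(i) = j,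
-- i.e. entry r (σ_r i) ≡ i; similarly for columns.
record LatinSquare (n : ℕ) : Set where
  field
    entry   : Array n
    row     : Fin n → Permutation′ n
    col     : Fin n → Permutation′ n
    rowSpec : ∀ r i → entry r (row r ⟨$⟩ʳ i) ≡ i
    colSpec : ∀ c i → entry (col c ⟨$⟩ʳ i) c ≡ i
open LatinSquare public

-- The Latin property for an array: each symbol at most once in each row
-- and column (equivalently, by finiteness, exactly once).
IsLatin : ∀ {n} → Array n → Set
IsLatin {n} A = (∀ r → Injective _≡_ _≡_ (A r))
              × (∀ c → Injective _≡_ _≡_ (λ r → A r c))

IsReducedLatin : ∀ {n} → Array (suc n) → Set
IsReducedLatin A = IsLatin A × (∀ c → A zero c ≡ c) × (∀ r → A r zero ≡ r)

record Isotopism (n : ℕ) : Set where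
  constructor iso
  field
    α β γ : Permutation′ n
open Isotopism public

-- Action: row in position r moves to α(r), column in position c to β(c),
-- symbol s replaced by γ(s).  So (Θ L)(α r, β c) = γ (L r c).
act : ∀ {n} → Isotopism n → Array n → Array n
act Θ A r c = γ Θ ⟨$⟩ʳ A (α Θ ⟨$⟩ˡ r) (β Θ ⟨$⟩ˡ c)

_≈ₚ_ : ∀ {n} → Permutation′ n → Permutation′ n → Set
π ≈ₚ ρ = ∀ i → π ⟨$⟩ʳ i ≡ ρ ⟨$⟩ʳ i

_≈ᵢ_ : ∀ {n} → Isotopism n → Isotopism n → Set
Θ ≈ᵢ Φ = (α Θ ≈ₚ α Φ) × (β Θ ≈ₚ β Φ) × (γ Θ ≈ₚ γ Φ)

canonical : ∀ {n} → LatinSquare (suc n) → Permutation′ (suc n) → Fin (suc n) → Isotopism (suc n)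
canonical L a j = iso a (a · col L j · (row L (a ⁻¹ ⟨$⟩ʳ zero)) ⁻¹) (a · col L j)

module Submission where

-- Write Θ = (α, β, γ), so that (Θ L)(α r, β c) = γ (L r c).
-- The two boundary conditions of a reduced square pin Θ down completely:
--   * first column of Θ L is the identity  ⇔  γ (L x j) = α x for all x,
--     where j = β⁻¹(1); reading L(·, j) through the column π_j this says γ = α π_j;
--   * first row of Θ L is the identity     ⇔  γ (L k c) = β c for all c,
--     where k = α⁻¹(1); reading L(k, ·) through the row σ_k this says
--     β = γ σ_k⁻¹ = α π_j σ_k⁻¹.
-- Conversely the canonical isotopism (α, α π_j σ_k⁻¹, α π_j) satisfies both
-- conditions, and any isotopism preserves the Latin property.

open import Defs
open import Data.Nat using (ℕ; suc)
open import Data.Fin using (Fin; zero)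
open import Data.Fin.Permutation using (Permutation′; _⟨$⟩ʳ_; _⟨$⟩ˡ_; inverseˡ; inverseʳ; flip)
open import Data.Product using (_×_; ∃-syntax; _,_)
open import Function.Bundles using (Injection)
open import Function.Definitions using (Injective)
open import Function.Properties.Inverse using (↔⇒↣)
open import Relation.Binary.PropositionalEquality using (_≡_; refl; sym; cong; cong₂; module ≡-Reasoning)
open ≡-Reasoning

applyʳ-injective : ∀ {n} (π : Permutation′ n) → Injective _≡_ _≡_ (π ⟨$⟩ʳ_)
applyʳ-injective π = Injection.injective (↔⇒↣ π)

applyˡ-injective : ∀ {n} (π : Permutation′ n) → Injective _≡_ _≡_ (π ⟨$⟩ˡ_)
applyˡ-injective π = applyʳ-injective (flip π)

act-at : ∀ {n} (Θ : Isotopism n) (A : Array n) (r c : Fin n) →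
         act Θ A (α Θ ⟨$⟩ʳ r) (β Θ ⟨$⟩ʳ c) ≡ γ Θ ⟨$⟩ʳ A r c
act-at Θ A r c = cong₂ (λ r′ c′ → γ Θ ⟨$⟩ʳ A r′ c′) (inverseˡ (α Θ)) (inverseˡ (β Θ))

-- Isotopisms preserve the Latin property: each row and column of Θ A is a
-- row or column of A precomposed with a bijection and postcomposed with γ.
act-preserves-Latin : ∀ {n} (Θ : Isotopism n) (A : Array n) → IsLatin A → IsLatin (act Θ A)
act-preserves-Latin Θ A (rowsInjective , colsInjective) =
  (λ r eq → applyˡ-injective (β Θ) (rowsInjective _ (applyʳ-injective (γ Θ) eq))) ,
  (λ c eq → applyˡ-injective (α Θ) (colsInjective _ (applyʳ-injective (γ Θ) eq)))

firstColumn-fixes-γ : ∀ {n} (Θ : Isotopism (suc n)) (A : Array (suc n)) →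
  (∀ r → act Θ A r zero ≡ r) → ∀ x → γ Θ ⟨$⟩ʳ A x (β Θ ⟨$⟩ˡ zero) ≡ α Θ ⟨$⟩ʳ x
firstColumn-fixes-γ Θ A firstColumn x = begin
  γ Θ ⟨$⟩ʳ A x (β Θ ⟨$⟩ˡ zero)                     ≡⟨ sym (act-at Θ A x _) ⟩
  act Θ A (α Θ ⟨$⟩ʳ x) (β Θ ⟨$⟩ʳ (β Θ ⟨$⟩ˡ zero))  ≡⟨ cong (act Θ A _) (inverseʳ (β Θ)) ⟩
  act Θ A (α Θ ⟨$⟩ʳ x) zero                         ≡⟨ firstColumn (α Θ ⟨$⟩ʳ x) ⟩
  α Θ ⟨$⟩ʳ x                                        ∎

firstRow-fixes-β : ∀ {n} (Θ : Isotopism (suc n)) (A : Array (suc n)) →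
  (∀ c → act Θ A zero c ≡ c) → ∀ c → γ Θ ⟨$⟩ʳ A (α Θ ⟨$⟩ˡ zero) c ≡ β Θ ⟨$⟩ʳ c
firstRow-fixes-β Θ A firstRow c = begin
  γ Θ ⟨$⟩ʳ A (α Θ ⟨$⟩ˡ zero) c                      ≡⟨ sym (act-at Θ A _ c) ⟩
  act Θ A (α Θ ⟨$⟩ʳ (α Θ ⟨$⟩ˡ zero)) (β Θ ⟨$⟩ʳ c)  ≡⟨ cong (λ r → act Θ A r _) (inverseʳ (α Θ)) ⟩
  act Θ A zero (β Θ ⟨$⟩ʳ c)                         ≡⟨ firstRow (β Θ ⟨$⟩ʳ c) ⟩
  β Θ ⟨$⟩ʳ c                                        ∎

module _ {n : ℕ} (L : LatinSquare n) where

  row-inverse : ∀ r c → row L r ⟨$⟩ˡ c ≡ entry L r c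
  row-inverse r c = begin
    row L r ⟨$⟩ˡ c                              ≡⟨ sym (rowSpec L r _) ⟩
    entry L r (row L r ⟨$⟩ʳ (row L r ⟨$⟩ˡ c))   ≡⟨ cong (entry L r) (inverseʳ (row L r)) ⟩
    entry L r c                                 ∎

  col-inverse : ∀ r c → col L c ⟨$⟩ˡ r ≡ entry L r c
  col-inverse r c = begin
    col L c ⟨$⟩ˡ r                              ≡⟨ sym (colSpec L c _) ⟩
    entry L (col L c ⟨$⟩ʳ (col L c ⟨$⟩ˡ r)) c   ≡⟨ cong (λ x → entry L x c) (inverseʳ (col L c)) ⟩
    entry L r c                                 ∎

  row-position : ∀ r c → row L r ⟨$⟩ʳ entry L r c ≡ c
  row-position r c = begin
    row L r ⟨$⟩ʳ entry L r c                ≡⟨ cong (row L r ⟨$⟩ʳ_) (sym (row-inverse r c)) ⟩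
    row L r ⟨$⟩ʳ (row L r ⟨$⟩ˡ c)           ≡⟨ inverseʳ (row L r) ⟩
    c                                       ∎

  col-position : ∀ r c → col L c ⟨$⟩ʳ entry L r c ≡ r
  col-position r c = begin
    col L c ⟨$⟩ʳ entry L r c                ≡⟨ cong (col L c ⟨$⟩ʳ_) (sym (col-inverse r c)) ⟩
    col L c ⟨$⟩ʳ (col L c ⟨$⟩ˡ r)           ≡⟨ inverseʳ (col L c) ⟩
    r                                       ∎

  -- The entry array of a Latin square has the Latin property, since its rows
  -- and columns are the inverse permutations σ_r⁻¹ and π_c⁻¹.
  entry-Latin : IsLatin (entry L)
  entry-Latin =
    (λ r {c} {c′} eq → applyˡ-injective (row L r)
        (begin row L r ⟨$⟩ˡ c ≡⟨ row-inverse r c ⟩ entry L r c ≡⟨ eq ⟩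
               entry L r c′ ≡⟨ sym (row-inverse r c′) ⟩ row L r ⟨$⟩ˡ c′ ∎)) ,
    (λ c {r} {r′} eq → applyˡ-injective (col L c)
        (begin col L c ⟨$⟩ˡ r ≡⟨ col-inverse r c ⟩ entry L r c ≡⟨ eq ⟩
               entry L r′ c ≡⟨ sym (col-inverse r′ c) ⟩ col L c ⟨$⟩ˡ r′ ∎))

module _ {n : ℕ} (L : LatinSquare (suc n)) where

  -- With k = α⁻¹(1),
  -- the first row of the image is row k of L read through σ_k, π_j and α,
  -- and the first column is column j of L read through π_j and α.
  canonical-reduces : ∀ a j → IsReducedLatin (act (canonical L a j) (entry L))
  canonical-reduces a j =
    act-preserves-Latin (canonical L a j) (entry L) (entry-Latin L) , firstRow , firstColumn
    where
    k : Fin (suc n)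
    k = a ⟨$⟩ˡ zero

    firstRow : ∀ c → act (canonical L a j) (entry L) zero c ≡ c
    firstRow c = begin
      a ⟨$⟩ʳ (col L j ⟨$⟩ʳ entry L k (row L k ⟨$⟩ʳ (col L j ⟨$⟩ˡ (a ⟨$⟩ˡ c))))
        ≡⟨ cong (λ s → a ⟨$⟩ʳ (col L j ⟨$⟩ʳ s)) (rowSpec L k _) ⟩
      a ⟨$⟩ʳ (col L j ⟨$⟩ʳ (col L j ⟨$⟩ˡ (a ⟨$⟩ˡ c)))
        ≡⟨ cong (a ⟨$⟩ʳ_) (inverseʳ (col L j)) ⟩
      a ⟨$⟩ʳ (a ⟨$⟩ˡ c)
        ≡⟨ inverseʳ a ⟩
      c ∎

    -- The column β⁻¹(1) of L is column j: σ_k (π_j⁻¹ k) = σ_k (L k j) = j.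
    preimage-of-first-column : row L k ⟨$⟩ʳ (col L j ⟨$⟩ˡ k) ≡ j
    preimage-of-first-column = begin
      row L k ⟨$⟩ʳ (col L j ⟨$⟩ˡ k)   ≡⟨ cong (row L k ⟨$⟩ʳ_) (col-inverse L k j) ⟩
      row L k ⟨$⟩ʳ entry L k j        ≡⟨ row-position L k j ⟩
      j                               ∎

    firstColumn : ∀ r → act (canonical L a j) (entry L) r zero ≡ r
    firstColumn r = begin
      a ⟨$⟩ʳ (col L j ⟨$⟩ʳ entry L (a ⟨$⟩ˡ r) (row L k ⟨$⟩ʳ (col L j ⟨$⟩ˡ k)))
        ≡⟨ cong (λ c → a ⟨$⟩ʳ (col L j ⟨$⟩ʳ entry L (a ⟨$⟩ˡ r) c)) preimage-of-first-column ⟩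
      a ⟨$⟩ʳ (col L j ⟨$⟩ʳ entry L (a ⟨$⟩ˡ r) j)
        ≡⟨ cong (a ⟨$⟩ʳ_) (col-position L (a ⟨$⟩ˡ r) j) ⟩
      a ⟨$⟩ʳ (a ⟨$⟩ˡ r)
        ≡⟨ inverseʳ a ⟩
      r ∎

  reducing-is-canonical : ∀ Θ → IsReducedLatin (act Θ (entry L)) →
                          Θ ≈ᵢ canonical L (α Θ) (β Θ ⟨$⟩ˡ zero)
  reducing-is-canonical Θ (_ , firstRow , firstColumn) = (λ _ → refl) , β-canonical , γ-canonical
    where
    j k : Fin (suc n)
    j = β Θ ⟨$⟩ˡ zero
    k = α Θ ⟨$⟩ˡ zero

    -- γ = α π_j, since every symbol s occurs in column j at row π_j(s).
    γ-canonical : ∀ s → γ Θ ⟨$⟩ʳ s ≡ α Θ ⟨$⟩ʳ (col L j ⟨$⟩ʳ s)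
    γ-canonical s = begin
      γ Θ ⟨$⟩ʳ s                                 ≡⟨ cong (γ Θ ⟨$⟩ʳ_) (sym (colSpec L j s)) ⟩
      γ Θ ⟨$⟩ʳ entry L (col L j ⟨$⟩ʳ s) j        ≡⟨ firstColumn-fixes-γ Θ (entry L) firstColumn _ ⟩
      α Θ ⟨$⟩ʳ (col L j ⟨$⟩ʳ s)                  ∎

    β-canonical : ∀ c → β Θ ⟨$⟩ʳ c ≡ α Θ ⟨$⟩ʳ (col L j ⟨$⟩ʳ (row L k ⟨$⟩ˡ c))
    β-canonical c = begin
      β Θ ⟨$⟩ʳ c                                 ≡⟨ sym (firstRow-fixes-β Θ (entry L) firstRow c) ⟩
      γ Θ ⟨$⟩ʳ entry L k c                       ≡⟨ γ-canonical (entry L k c) ⟩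
      α Θ ⟨$⟩ʳ (col L j ⟨$⟩ʳ entry L k c)        ≡⟨ cong (λ s → α Θ ⟨$⟩ʳ (col L j ⟨$⟩ʳ s)) (sym (row-inverse L k c)) ⟩
      α Θ ⟨$⟩ʳ (col L j ⟨$⟩ʳ (row L k ⟨$⟩ˡ c))   ∎

-- Proposition 2.2.  Both directions hold for every Latin square.
proposition2p2 : ∀ {n : ℕ} (L : LatinSquare (suc n)) → IsReducedLatin (entry L) →
    (∀ (a : Permutation′ (suc n)) (j : Fin (suc n)) → IsReducedLatin (act (canonical L a j) (entry L)))
    × (∀ (Θ : Isotopism (suc n)) → IsReducedLatin (act Θ (entry L)) →
    ∃[ a ] ∃[ j ] (Θ ≈ᵢ canonical L a j))
proposition2p2 L _ =
  canonical-reduces L ,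
  λ Θ reduced → α Θ , β Θ ⟨$⟩ˡ zero , reducing-is-canonical L Θ reduced
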